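{- Let $N$ and $H$ be finite groups, $\theta:H\to\mathrm{Aut}(N)$ a homomorphism and $G=N\rtimes_\theta H$. Let $\mathcal{O}_1=\{e_N\},\mathcal{O}_2,\dots,\mathcal{O}_s$ ($s\ge 2$) be all the distinct $H$-orbits of $N$ under $h\cdot n=\theta(h)(n)$, with $d_i=|\mathcal{O}_i|$, ordered so that $d_1\le d_2\le\dots\le d_s$, and suppose $1<d_2$ and $d_2\mid d_i$ for all $2\le i\le s$. Let $r$ be an integer with $1\le r<d_2$, let $\widetilde{\mathcal{O}}_i\subseteq\mathcal{O}_i$ with $|\widetilde{\mathcal{O}}_i|=\frac{rd_i}{d_2}$ for $2\le i\le s$, and let $N_1=\bigcup_{i=2}^s\widetilde{\mathcal{O}}_i$. Then the Cayley graph $\mathcal{C}(G,N_1\times H)$ is a directed strongly regular graph with parameters $$\left(|G|,\;\frac{r|H|(|N|-1)}{d_2},\;\frac{r^2|H|(|N|-1)}{d_2^2},\;\frac{r^2|H|(|N|-1)}{d_2^2}-\frac{r|H|}{d_2},\;\frac{r^2|H|(|N|-1)}{d_2^2}\right).$$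
   Context: $N\rtimes_\theta H$ is $N\times H$ with product $(n,h)(n',h')=(n\,\theta(h)(n'),hh')$; $N_1\times H=\{(n,h):n\in N_1,h\in H\}$. For $S\subseteq G\setminus\{e\}$, $\mathcal{C}(G,S)$ has vertex set $G$ and an arc $x\to y$ iff $yx^{ -1}\in S$. A directed graph on $n$ vertices with $0/1$ adjacency matrix $A$ is a directed strongly regular graph with parameters $(n,k,\mu,\lambda,t)$ if $JA=AJ=kJ$ and $A^2=tI+\lambda A+\mu(J-I-A)$, $J$ the all-ones matrix. -}

module Defs where

open import Data.Nat using (ℕ; zero; suc; _+_; _*_; _∸_; _/_; _≤_; _<_)
open import Data.Fin using (Fin)
open import Data.Fin.Properties using (_≟_; any?)
open import Data.Bool using (Bool; true; false; if_then_else_)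
open import Data.List using (List; map; length; allFin; cartesianProduct)
open import Data.Nat.ListAction using (sum)
open import Data.Product using (_×_; _,_; proj₁; proj₂)
open import Data.Integer as ℤ using (ℤ; +_)
open import Relation.Nullary using (does; Dec)
open import Relation.Binary.PropositionalEquality using (_≡_)
open import Algebra.Structures using (IsGroup)
open import Function.Definitions using (Bijective)
import Data.Product.Properties as ×P

-- Exact division convention: a ÷ d = ⌊a/d⌋ for d ≠ 0 (only used when d divides a).
_÷_ : ℕ → ℕ → ℕ
a ÷ zero = 0
a ÷ suc d = a / suc d

record FinGroup (n : ℕ) : Set where
  field
    _∙_ : Fin n → Fin n → Fin n
    ε : Fin n
    _⁻¹ : Fin n → Fin n
    isGroup : IsGroup _≡_ _∙_ ε _⁻¹

record IsAutAction {n m : ℕ} (N : FinGroup n) (H : FinGroup m)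
                   (θ : Fin m → Fin n → Fin n) : Set where
  open FinGroup N renaming (_∙_ to _·N_)
  open FinGroup H renaming (_∙_ to _·H_)
  field
    θ-hom-N   : ∀ h a b → θ h (a ·N b) ≡ θ h a ·N θ h b
    θ-bij     : ∀ h → Bijective _≡_ _≡_ (θ h)
    θ-hom-H   : ∀ h h' a → θ (h ·H h') a ≡ θ h (θ h' a)

countB : ∀ {n} → (Fin n → Bool) → ℕ
countB {n} p = sum (map (λ i → if p i then 1 else 0) (allFin n))

inOrbit : ∀ {n m} → (Fin m → Fin n → Fin n) → Fin n → Fin n → Bool
inOrbit θ x y = does (any? (λ h → θ h x ≟ y))

orbitSize : ∀ {n m} → (Fin m → Fin n → Fin n) → Fin n → ℕ
orbitSize θ x = countB (inOrbit θ x)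

orbitPartSize : ∀ {n m} → (Fin m → Fin n → Fin n) → (Fin n → Bool) → Fin n → ℕ
orbitPartSize θ P x = countB (λ y → if inOrbit θ x y then P y else false)

module SemiDirect {n m : ℕ} (N : FinGroup n) (H : FinGroup m)
                  (θ : Fin m → Fin n → Fin n) where
  open FinGroup N renaming (_∙_ to _·N_; ε to eN; _⁻¹ to invN)
  open FinGroup H renaming (_∙_ to _·H_; ε to eH; _⁻¹ to invH)

  G : Set
  G = Fin n × Fin m

  _·G_ : G → G → G
  (a , h) ·G (a' , h') = (a ·N θ h a' , h ·H h')

  invG : G → G
  invG (a , h) = (θ (invH h) (invN a) , invH h)

  _≟G_ : (x y : G) → Dec (x ≡ y)
  _≟G_ = ×P.≡-dec _≟_ _≟_

  elemsG : List G
  elemsG = cartesianProduct (allFin n) (allFin m)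

  inN1xH : (Fin n → Bool) → G → Bool
  inN1xH N1 (a , h) = N1 a

  cayleyArc : (G → Bool) → G → G → Bool
  cayleyArc S x y = S (y ·G invG x)

-- Directed strongly regular graphs, for a digraph on a finite vertex type V
-- (enumerated without repetition by vs) given by its arc relation.
module DSRG {V : Set} (_≟V_ : (x y : V) → Dec (x ≡ y))
            (vs : List V) (arc : V → V → Bool) where

  A : V → V → ℕ
  A x y = if arc x y then 1 else 0

  I : V → V → ℕ
  I x y = if does (x ≟V y) then 1 else 0

  record IsDSRG (v k μ λ' t : ℕ) : Set where
    field
      order : length vs ≡ v
      JA : ∀ y → sum (map (λ x → A x y) vs) ≡ k
      AJ : ∀ x → sum (map (λ y → A x y) vs) ≡ k
      A² : ∀ x y → + sum (map (λ z → A x z * A z y) vs)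
                   ≡ (+ t) ℤ.* (+ I x y) ℤ.+ (+ λ') ℤ.* (+ A x y)
                     ℤ.+ (+ μ) ℤ.* ((+ 1) ℤ.- (+ I x y) ℤ.- (+ A x y))

-- Whether x = (a, h) → y = (b, h′) is an arc depends only on the N-component
-- β = b · θ h′ α of y x⁻¹, where α = θ h⁻¹ (a⁻¹). Let hits w = #{h ∈ H | θ h w ∈ N₁}. By
-- orbit–stabiliser, hits w = |Stab w| · |N₁ ∩ H·w| = r|H|/d₂ =: K for every w ≠ e, while
-- hits e = 0. After substituting along θ, the two-step paths from x to y are counted by
-- Σ_c hits (c α) · [b θ h′ (c⁻¹) ∈ N₁], which is K (|N₁| − [β ∈ N₁]); hence A² + K A = K |N₁| J.
-- Double counting the pairs (h, w) with θ h w ∈ N₁ gives d₂ |N₁| = r (|N| − 1), and the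
-- parameters follow with t = μ = K |N₁| and λ = μ − K.

module Submission where

open import Defs
open import Algebra.Bundles using (Group)
import Algebra.Properties.Group as GroupProperties
import Algebra.Properties.Loop as LoopProperties
import Algebra.Properties.Quasigroup as QuasigroupProperties
open import Data.Bool using (Bool; true; false; if_then_else_)
open import Data.Empty using (⊥-elim)
open import Data.Fin using (Fin; zero; suc)
open import Data.Fin.Permutation using (Permutation′; permutation; _∘ₚ_)
open import Data.Fin.Properties using (_≟_; any?; nonZeroIndex)
import Data.Integer as ℤ
import Data.Integer.Tactic.RingSolver as ℤ-Solver
open import Data.List using (List; []; _∷_; _++_; map; length; allFin; tabulate; cartesianProduct)
import Data.List.Properties as List
open import Data.Nat using (ℕ; zero; suc; _+_; _*_; _∸_; _<_; _≤_; s≤s)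
open import Data.Nat.Divisibility using (_∣_; divides)
open import Data.Nat.DivMod using (m*n/n≡m)
import Data.Nat.ListAction as ListAction
open import Data.Nat.ListAction.Properties using (sum-++)
open import Data.Nat.Properties hiding (_≟_)
open import Algebra.Properties.Semiring.Sum +-*-semiring
  using (sum-syntax; ∑-comm; ∑-distrib-+; ∑-permute; sum-cong-≗; *-distribˡ-sum; *-distribʳ-sum)
open import Data.Nat.Tactic.RingSolver using (solve-∀)
open import Data.Product using (_×_; _,_; proj₁)
open import Function using (_∘_; id)
open import Function.Definitions using (Injective)
open import Level using (0ℓ)
open import Relation.Nullary using (does; yes; no)
open import Relation.Binary.PropositionalEquality

𝟙 : Bool → ℕ
𝟙 b = if b then 1 else 0

𝟙-if : ∀ b c → 𝟙 (if b then c else false) ≡ 𝟙 b * 𝟙 c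
𝟙-if true  c = sym (+-identityʳ (𝟙 c))
𝟙-if false c = refl

δ : ∀ {k} → Fin k → Fin k → ℕ
δ i j = 𝟙 (does (i ≟ j))

δ-injective : ∀ {k} {f : Fin k → Fin k} → Injective _≡_ _≡_ f → ∀ i j → δ (f i) (f j) ≡ δ i j
δ-injective {f = f} f-inj i j with i ≟ j | f i ≟ f j
... | yes _   | yes _    = refl
... | yes i≡j | no fi≢fj = ⊥-elim (fi≢fj (cong f i≡j))
... | no i≢j  | yes fi≡fj = ⊥-elim (i≢j (f-inj fi≡fj))
... | no _    | no _     = refl

δ-≢ : ∀ {k} {i j : Fin k} → i ≢ j → δ i j ≡ 0
δ-≢ {i = i} {j} i≢j with i ≟ j
... | yes i≡j = ⊥-elim (i≢j i≡j)
... | no _    = refl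

sum-tabulate : ∀ {n} (f : Fin n → ℕ) → ListAction.sum (tabulate f) ≡ ∑[ i < n ] f i
sum-tabulate {zero}  f = refl
sum-tabulate {suc n} f = cong (f zero +_) (sum-tabulate (f ∘ suc))

sum-allFin : ∀ {n} (f : Fin n → ℕ) → ListAction.sum (map f (allFin n)) ≡ ∑[ i < n ] f i
sum-allFin f = trans (cong ListAction.sum (List.map-tabulate id f)) (sum-tabulate f)

sum-cartesianProduct : ∀ {A B : Set} (F : A × B → ℕ) (xs : List A) (ys : List B) →
  ListAction.sum (map F (cartesianProduct xs ys))
    ≡ ListAction.sum (map (λ x → ListAction.sum (map (λ y → F (x , y)) ys)) xs)
sum-cartesianProduct F []       ys = refl
sum-cartesianProduct F (x ∷ xs) ys = begin
  ListAction.sum (map F (map (x ,_) ys ++ cartesianProduct xs ys))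
    ≡⟨ cong ListAction.sum (List.map-++ F (map (x ,_) ys) _) ⟩
  ListAction.sum (map F (map (x ,_) ys) ++ map F (cartesianProduct xs ys))
    ≡⟨ sum-++ (map F (map (x ,_) ys)) _ ⟩
  ListAction.sum (map F (map (x ,_) ys)) + ListAction.sum (map F (cartesianProduct xs ys))
    ≡⟨ cong₂ _+_ (cong ListAction.sum (sym (List.map-∘ ys))) (sum-cartesianProduct F xs ys) ⟩
  ListAction.sum (map (λ y → F (x , y)) ys)
    + ListAction.sum (map (λ x → ListAction.sum (map (λ y → F (x , y)) ys)) xs) ∎
  where open ≡-Reasoning

sum-allFin×allFin : ∀ {n m} (F : Fin n × Fin m → ℕ) →
  ListAction.sum (map F (cartesianProduct (allFin n) (allFin m))) ≡ ∑[ a < n ] ∑[ h < m ] F (a , h)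
sum-allFin×allFin {n} {m} F = begin
  ListAction.sum (map F (cartesianProduct (allFin n) (allFin m)))
    ≡⟨ sum-cartesianProduct F (allFin n) (allFin m) ⟩
  ListAction.sum (map (λ a → ListAction.sum (map (λ h → F (a , h)) (allFin m))) (allFin n))
    ≡⟨ cong ListAction.sum (List.map-cong (λ a → sum-allFin (λ h → F (a , h))) (allFin n)) ⟩
  ListAction.sum (map (λ a → ∑[ h < m ] F (a , h)) (allFin n))
    ≡⟨ sum-allFin (λ a → ∑[ h < m ] F (a , h)) ⟩
  ∑[ a < n ] ∑[ h < m ] F (a , h) ∎
  where open ≡-Reasoning

length-cartesianProduct : ∀ {A B : Set} (xs : List A) (ys : List B) →
  length (cartesianProduct xs ys) ≡ length xs * length ys
length-cartesianProduct []       ys = refl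
length-cartesianProduct (x ∷ xs) ys =
  trans (List.length-++ (map (x ,_) ys))
        (cong₂ _+_ (List.length-map (x ,_) ys) (length-cartesianProduct xs ys))

∑-const : ∀ n c → ∑[ i < n ] c ≡ n * c
∑-const zero    c = refl
∑-const (suc n) c = cong (c +_) (∑-const n c)

∑-zero : ∀ {n} (f : Fin n → ℕ) → (∀ i → f i ≡ 0) → ∑[ i < n ] f i ≡ 0
∑-zero {n} f f≡0 = trans (sum-cong-≗ f≡0) (trans (∑-const n 0) (*-zeroʳ n))

∑-δ : ∀ {k} (p : Fin k) (g : Fin k → ℕ) → ∑[ i < k ] (δ p i * g i) ≡ g p
∑-δ {suc k} zero g =
  trans (cong₂ _+_ (+-identityʳ (g zero)) (trans (∑-const k 0) (*-zeroʳ k))) (+-identityʳ (g zero))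
∑-δ {suc k} (suc p) g = ∑-δ p (g ∘ suc)

-- The hypothesis says that f vanishes at p and equals c elsewhere.
∑-punctured : ∀ {k} (p : Fin k) c (f g : Fin k → ℕ) → (∀ i → f i + δ p i * c ≡ c) →
  ∑[ i < k ] (f i * g i) + c * g p ≡ c * ∑[ i < k ] g i
∑-punctured {k} p c f g f+δc≡c = begin
  ∑[ i < k ] (f i * g i) + c * g p
    ≡⟨ cong (∑[ i < k ] (f i * g i) +_) (∑-δ p (λ i → c * g i)) ⟨
  ∑[ i < k ] (f i * g i) + ∑[ i < k ] (δ p i * (c * g i))
    ≡⟨ ∑-distrib-+ (λ i → f i * g i) (λ i → δ p i * (c * g i)) ⟨
  ∑[ i < k ] (f i * g i + δ p i * (c * g i))
    ≡⟨ sum-cong-≗ term ⟩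
  ∑[ i < k ] (c * g i)
    ≡⟨ *-distribˡ-sum c g ⟨
  c * ∑[ i < k ] g i ∎
  where
  open ≡-Reasoning
  term : ∀ i → f i * g i + δ p i * (c * g i) ≡ c * g i
  term i = begin
    f i * g i + δ p i * (c * g i) ≡⟨ cong (f i * g i +_) (*-assoc (δ p i) c (g i)) ⟨
    f i * g i + δ p i * c * g i   ≡⟨ *-distribʳ-+ (g i) (f i) (δ p i * c) ⟨
    (f i + δ p i * c) * g i       ≡⟨ cong (_* g i) (f+δc≡c i) ⟩
    c * g i ∎

÷-exact : ∀ {a b d} → a * suc d ≡ b → b ÷ suc d ≡ a
÷-exact {a} {d = d} refl = m*n/n≡m a (suc d)

module _ where
  open import Data.Integer using (+_)

  private
    entry-non-arc : ∀ u v i → u ℤ.* i ℤ.+ v ℤ.* (+ 0) ℤ.+ u ℤ.* ((+ 1) ℤ.- i ℤ.- (+ 0)) ≡ u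
    entry-non-arc = ℤ-Solver.solve-∀

    entry-arc : ∀ u v → u ℤ.* (+ 0) ℤ.+ v ℤ.* (+ 1) ℤ.+ u ℤ.* ((+ 1) ℤ.- (+ 0) ℤ.- (+ 1)) ≡ v
    entry-arc = ℤ-Solver.solve-∀

  dsrg-entry : ∀ {L c μ} (i a : Bool) → (i ≡ true → a ≡ false) → L + c * 𝟙 a ≡ μ →
    + L ≡ (+ μ) ℤ.* (+ 𝟙 i) ℤ.+ (+ (μ ∸ c)) ℤ.* (+ 𝟙 a)
          ℤ.+ (+ μ) ℤ.* ((+ 1) ℤ.- (+ 𝟙 i) ℤ.- (+ 𝟙 a))
  dsrg-entry true  true  irreflexive _ with () ← irreflexive refl
  dsrg-entry {L} {c} {μ} i false _ L+c*0≡μ = begin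
    + L           ≡⟨ cong +_ (trans (cong (λ t → L + t) (*-zeroʳ c)) (+-identityʳ L)) ⟨
    + (L + c * 0) ≡⟨ cong +_ L+c*0≡μ ⟩
    + μ           ≡⟨ entry-non-arc (+ μ) (+ (μ ∸ c)) (+ 𝟙 i) ⟨
    _ ∎
    where open ≡-Reasoning
  dsrg-entry {L} {c} {μ} false true _ L+c*1≡μ = begin
    + L               ≡⟨ cong +_ (m+n∸n≡m L c) ⟨
    + (L + c ∸ c)     ≡⟨ cong (λ t → + (L + t ∸ c)) (*-identityʳ c) ⟨
    + (L + c * 1 ∸ c) ≡⟨ cong (λ t → + (t ∸ c)) L+c*1≡μ ⟩
    + (μ ∸ c)         ≡⟨ entry-arc (+ μ) (+ (μ ∸ c)) ⟨
    _ ∎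
    where open ≡-Reasoning

group : ∀ {k} → FinGroup k → Group 0ℓ 0ℓ
group {k} G = record
  { Carrier = Fin k ; _≈_ = _≡_ ; _∙_ = _∙_ ; ε = ε ; _⁻¹ = _⁻¹ ; isGroup = isGroup }
  where open FinGroup G

module FinGroupPermutations {k} (G : FinGroup k) where
  open FinGroup G using (_∙_; _⁻¹)
  open GroupProperties (group G)

  translateˡ : Fin k → Permutation′ k
  translateˡ c = permutation (c ∙_) ((c ⁻¹) ∙_) (\\-leftDividesˡ c) (\\-leftDividesʳ c)

  translateʳ : Fin k → Permutation′ k
  translateʳ c = permutation (_∙ c) (_∙ (c ⁻¹)) (//-rightDividesˡ c) (//-rightDividesʳ c)

  inversion : Permutation′ k
  inversion = permutation _⁻¹ _⁻¹ ⁻¹-involutive ⁻¹-involutive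

module AutAction {n m} {N : FinGroup n} {H : FinGroup m} {θ : Fin m → Fin n → Fin n}
                 (act : IsAutAction N H θ) where
  open IsAutAction act
  open Group (group N) using (_∙_; ε; _⁻¹; inverseʳ; identityˡ)
  open GroupProperties (group N) using (inverseʳ-unique; loop)
  open LoopProperties loop using (identityˡ-unique)
  module ℍ where
    open Group (group H) public using (_∙_; ε; _⁻¹; identityˡ; inverseˡ; inverseʳ)
    open FinGroupPermutations H public

  θ-injective : ∀ h → Injective _≡_ _≡_ (θ h)
  θ-injective h = proj₁ (θ-bij h)

  θ-identity : ∀ a → θ ℍ.ε a ≡ a
  θ-identity a = θ-injective ℍ.ε
    (trans (sym (θ-hom-H ℍ.ε ℍ.ε a)) (cong (λ g → θ g a) (ℍ.identityˡ ℍ.ε)))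

  θ-inverseˡ : ∀ h a → θ (h ℍ.⁻¹) (θ h a) ≡ a
  θ-inverseˡ h a =
    trans (sym (θ-hom-H _ h a)) (trans (cong (λ g → θ g a) (ℍ.inverseˡ h)) (θ-identity a))

  θ-inverseʳ : ∀ h a → θ h (θ (h ℍ.⁻¹) a) ≡ a
  θ-inverseʳ h a =
    trans (sym (θ-hom-H h _ a)) (trans (cong (λ g → θ g a) (ℍ.inverseʳ h)) (θ-identity a))

  θ-ε : ∀ h → θ h ε ≡ ε
  θ-ε h = identityˡ-unique (θ h ε) (θ h ε)
    (trans (sym (θ-hom-N h ε ε)) (cong (θ h) (identityˡ ε)))

  θ-⁻¹ : ∀ h a → θ h (a ⁻¹) ≡ θ h a ⁻¹
  θ-⁻¹ h a = inverseʳ-unique (θ h a) (θ h (a ⁻¹))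
    (trans (sym (θ-hom-N h a (a ⁻¹))) (trans (cong (θ h) (inverseʳ a)) (θ-ε h)))

  θ-permutation : Fin m → Permutation′ n
  θ-permutation h = permutation (θ h) (θ (h ℍ.⁻¹)) (θ-inverseʳ h) (θ-inverseˡ h)

  stabiliserSize : Fin n → ℕ
  stabiliserSize w = ∑[ j < m ] δ (θ j w) w

  ∑-δ-orbit : ∀ w y → ∑[ j < m ] δ (θ j w) y ≡ 𝟙 (inOrbit θ w y) * stabiliserSize w
  ∑-δ-orbit w y with any? (λ h → θ h w ≟ y)
  ... | yes (g , refl) = begin
    ∑[ j < m ] δ (θ j w) (θ g w)          ≡⟨ ∑-permute (λ j → δ (θ j w) (θ g w)) (ℍ.translateˡ g) ⟩
    ∑[ j < m ] δ (θ (g ℍ.∙ j) w) (θ g w)  ≡⟨ sum-cong-≗ (λ j → cong (λ x → δ x (θ g w)) (θ-hom-H g j w)) ⟩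
    ∑[ j < m ] δ (θ g (θ j w)) (θ g w)    ≡⟨ sum-cong-≗ (λ j → δ-injective (θ-injective g) (θ j w) w) ⟩
    stabiliserSize w                      ≡⟨ +-identityʳ (stabiliserSize w) ⟨
    1 * stabiliserSize w                  ∎
    where open ≡-Reasoning
  ... | no ∉orbit = ∑-zero _ (λ j → δ-≢ (λ θjw≡y → ∉orbit (j , θjw≡y)))

  ∑-orbit : ∀ w (g : Fin n → ℕ) →
    ∑[ j < m ] g (θ j w) ≡ stabiliserSize w * ∑[ y < n ] (𝟙 (inOrbit θ w y) * g y)
  ∑-orbit w g = begin
    ∑[ j < m ] g (θ j w)
      ≡⟨ sum-cong-≗ (λ j → ∑-δ (θ j w) g) ⟨
    ∑[ j < m ] ∑[ y < n ] (δ (θ j w) y * g y)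
      ≡⟨ ∑-comm (λ j y → δ (θ j w) y * g y) ⟩
    ∑[ y < n ] ∑[ j < m ] (δ (θ j w) y * g y)
      ≡⟨ sum-cong-≗ (λ y → *-distribʳ-sum (g y) (λ j → δ (θ j w) y)) ⟨
    ∑[ y < n ] (∑[ j < m ] δ (θ j w) y * g y)
      ≡⟨ sum-cong-≗ (λ y → cong (_* g y) (∑-δ-orbit w y)) ⟩
    ∑[ y < n ] (𝟙 (inOrbit θ w y) * s * g y)
      ≡⟨ sum-cong-≗ (λ y →
           trans (cong (_* g y) (*-comm (𝟙 (inOrbit θ w y)) s)) (*-assoc s _ (g y))) ⟩
    ∑[ y < n ] (s * (𝟙 (inOrbit θ w y) * g y))
      ≡⟨ *-distribˡ-sum s (λ y → 𝟙 (inOrbit θ w y) * g y) ⟨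
    s * ∑[ y < n ] (𝟙 (inOrbit θ w y) * g y) ∎
    where
    open ≡-Reasoning
    s = stabiliserSize w

  orbit-stabiliser : ∀ w → m ≡ stabiliserSize w * orbitSize θ w
  orbit-stabiliser w = begin
    m                    ≡⟨ trans (∑-const m 1) (*-identityʳ m) ⟨
    ∑[ j < m ] 1         ≡⟨ ∑-orbit w (λ _ → 1) ⟩
    s * ∑[ y < n ] (𝟙 (inOrbit θ w y) * 1)
      ≡⟨ cong (s *_) (sum-cong-≗ (λ y → *-identityʳ (𝟙 (inOrbit θ w y)))) ⟩
    s * ∑[ y < n ] 𝟙 (inOrbit θ w y)
      ≡⟨ cong (s *_) (sum-allFin (𝟙 ∘ inOrbit θ w)) ⟨
    s * orbitSize θ w    ∎
    where
    open ≡-Reasoning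
    s = stabiliserSize w

  ∑-orbit-𝟙 : ∀ (P : Fin n → Bool) w →
    ∑[ j < m ] 𝟙 (P (θ j w)) ≡ stabiliserSize w * orbitPartSize θ P w
  ∑-orbit-𝟙 P w = begin
    ∑[ j < m ] 𝟙 (P (θ j w))
      ≡⟨ ∑-orbit w (𝟙 ∘ P) ⟩
    s * ∑[ y < n ] (𝟙 (inOrbit θ w y) * 𝟙 (P y))
      ≡⟨ cong (s *_) (sum-cong-≗ (λ y → 𝟙-if (inOrbit θ w y) (P y))) ⟨
    s * ∑[ y < n ] 𝟙 (if inOrbit θ w y then P y else false)
      ≡⟨ cong (s *_) (sum-allFin (λ y → 𝟙 (if inOrbit θ w y then P y else false))) ⟨
    s * orbitPartSize θ P w ∎
    where
    open ≡-Reasoning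
    s = stabiliserSize w

module CayleyDigraph {n m} {N : FinGroup n} {H : FinGroup m} {θ : Fin m → Fin n → Fin n}
  (act : IsAutAction N H θ) (d : ℕ) (x₂ : Fin n) (x₂≢ε : x₂ ≢ FinGroup.ε N) (r : ℕ)
  (N₁ : Fin n → Bool) (N₁-ε : N₁ (FinGroup.ε N) ≡ false)
  (d₂∣orbit : ∀ x → x ≢ FinGroup.ε N → suc d ∣ orbitSize θ x)
  (N₁-orbit : ∀ x → x ≢ FinGroup.ε N → orbitPartSize θ N₁ x ≡ (r * orbitSize θ x) ÷ suc d)
  where

  open IsAutAction act
  open AutAction act
  open Group (group N) using (_∙_; ε; _⁻¹; inverseˡ; inverseʳ)
  open GroupProperties (group N) using (⁻¹-involutive; quasigroup)
  open QuasigroupProperties quasigroup using (cancelʳ)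
  open FinGroupPermutations N
  open ≡-Reasoning

  d₂ : ℕ
  d₂ = suc d

  |N₁| : ℕ
  |N₁| = ∑[ a < n ] 𝟙 (N₁ a)

  hits : Fin n → ℕ
  hits w = ∑[ h < m ] 𝟙 (N₁ (θ h w))

  K : ℕ
  K = (r * m) ÷ d₂

  hits-ε : hits ε ≡ 0
  hits-ε = ∑-zero _ (λ h → cong 𝟙 (trans (cong N₁ (θ-ε h)) N₁-ε))

  hits*d₂≡r*m : ∀ w → w ≢ ε → hits w * d₂ ≡ r * m
  hits*d₂≡r*m w w≢ε with d₂∣orbit w w≢ε
  ... | divides q |Hw|≡q*d₂ = begin
    hits w * d₂                          ≡⟨ cong (_* d₂) (∑-orbit-𝟙 N₁ w) ⟩
    s * orbitPartSize θ N₁ w * d₂        ≡⟨ cong (λ t → s * t * d₂) (N₁-orbit w w≢ε) ⟩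
    s * ((r * orbitSize θ w) ÷ d₂) * d₂  ≡⟨ cong (λ t → s * ((r * t) ÷ d₂) * d₂) |Hw|≡q*d₂ ⟩
    s * ((r * (q * d₂)) ÷ d₂) * d₂       ≡⟨ cong (λ t → s * t * d₂) (÷-exact (*-assoc r q d₂)) ⟩
    s * (r * q) * d₂                     ≡⟨ regroup s r q d₂ ⟩
    r * (s * (q * d₂))                   ≡⟨ cong (λ t → r * (s * t)) |Hw|≡q*d₂ ⟨
    r * (s * orbitSize θ w)              ≡⟨ cong (r *_) (orbit-stabiliser w) ⟨
    r * m                                ∎
    where
    s = stabiliserSize w
    regroup : ∀ a b c e → a * (b * c) * e ≡ b * (a * (c * e))
    regroup = solve-∀

  hits-nontrivial : ∀ w → w ≢ ε → hits w ≡ K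
  hits-nontrivial w w≢ε = sym (÷-exact (hits*d₂≡r*m w w≢ε))

  K*d₂≡r*m : K * d₂ ≡ r * m
  K*d₂≡r*m = trans (cong (_* d₂) (sym (hits-nontrivial x₂ x₂≢ε))) (hits*d₂≡r*m x₂ x₂≢ε)

  hits+δ : ∀ w → hits w + δ ε w * K ≡ K
  hits+δ w with ε ≟ w
  ... | yes refl = trans (cong (_+ 1 * K) hits-ε) (*-identityˡ K)
  ... | no ε≢w   = trans (+-identityʳ (hits w)) (hits-nontrivial w (ε≢w ∘ sym))

  ∑-hits : ∑[ w < n ] hits w ≡ m * |N₁|
  ∑-hits = begin
    ∑[ w < n ] ∑[ h < m ] 𝟙 (N₁ (θ h w)) ≡⟨ ∑-comm (λ w h → 𝟙 (N₁ (θ h w))) ⟩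
    ∑[ h < m ] ∑[ w < n ] 𝟙 (N₁ (θ h w))
      ≡⟨ sum-cong-≗ (λ h → ∑-permute (𝟙 ∘ N₁) (θ-permutation h)) ⟨
    ∑[ h < m ] |N₁|                      ≡⟨ ∑-const m |N₁| ⟩
    m * |N₁|                             ∎

  m*|N₁|+K≡n*K : m * |N₁| + K ≡ n * K
  m*|N₁|+K≡n*K = begin
    m * |N₁| + K
      ≡⟨ cong₂ _+_ ∑-hits (∑-δ ε (λ _ → K)) ⟨
    ∑[ w < n ] hits w + ∑[ w < n ] (δ ε w * K)
      ≡⟨ ∑-distrib-+ hits (λ w → δ ε w * K) ⟨
    ∑[ w < n ] (hits w + δ ε w * K) ≡⟨ sum-cong-≗ hits+δ ⟩
    ∑[ w < n ] K                    ≡⟨ ∑-const n K ⟩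
    n * K                           ∎

  |N₁|*d₂≡[n∸1]*r : |N₁| * d₂ ≡ (n ∸ 1) * r
  |N₁|*d₂≡[n∸1]*r = begin
    |N₁| * d₂           ≡⟨ m+n∸n≡m (|N₁| * d₂) r ⟨
    |N₁| * d₂ + r ∸ r   ≡⟨ cong (_∸ r) (*-cancelˡ-≡ _ _ m {{nonZeroIndex (FinGroup.ε H)}} scaled) ⟩
    n * r ∸ r           ≡⟨ cong (n * r ∸_) (*-identityˡ r) ⟨
    n * r ∸ 1 * r       ≡⟨ *-distribʳ-∸ r n 1 ⟨
    (n ∸ 1) * r         ∎
    where
    scaled : m * (|N₁| * d₂ + r) ≡ m * (n * r)
    scaled = begin
      m * (|N₁| * d₂ + r)        ≡⟨ distribute m |N₁| d₂ r ⟩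
      m * |N₁| * d₂ + r * m      ≡⟨ cong (m * |N₁| * d₂ +_) K*d₂≡r*m ⟨
      m * |N₁| * d₂ + K * d₂     ≡⟨ *-distribʳ-+ d₂ (m * |N₁|) K ⟨
      (m * |N₁| + K) * d₂        ≡⟨ cong (_* d₂) m*|N₁|+K≡n*K ⟩
      n * K * d₂                 ≡⟨ *-assoc n K d₂ ⟩
      n * (K * d₂)               ≡⟨ cong (n *_) K*d₂≡r*m ⟩
      n * (r * m)                ≡⟨ rotate n r m ⟩
      m * (n * r)                ∎
      where
      distribute : ∀ a b c e → a * (b * c + e) ≡ a * b * c + e * a
      distribute = solve-∀
      rotate : ∀ a b c → a * (b * c) ≡ c * (a * b)
      rotate = solve-∀

  degree-value : (r * m * (n ∸ 1)) ÷ d₂ ≡ m * |N₁|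
  degree-value = ÷-exact (begin
    m * |N₁| * d₂       ≡⟨ *-assoc m |N₁| d₂ ⟩
    m * (|N₁| * d₂)     ≡⟨ cong (m *_) |N₁|*d₂≡[n∸1]*r ⟩
    m * ((n ∸ 1) * r)   ≡⟨ rearrange m (n ∸ 1) r ⟩
    r * m * (n ∸ 1)     ∎)
    where
    rearrange : ∀ a b c → a * (b * c) ≡ c * a * b
    rearrange = solve-∀

  μ-value : (r * r * m * (n ∸ 1)) ÷ (d₂ * d₂) ≡ K * |N₁|
  μ-value = ÷-exact (begin
    K * |N₁| * (d₂ * d₂)          ≡⟨ interchange K |N₁| d₂ ⟩
    K * d₂ * (|N₁| * d₂)          ≡⟨ cong₂ _*_ K*d₂≡r*m |N₁|*d₂≡[n∸1]*r ⟩
    r * m * ((n ∸ 1) * r)         ≡⟨ rearrange r m (n ∸ 1) ⟩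
    r * r * m * (n ∸ 1)           ∎)
    where
    interchange : ∀ a b c → a * b * (c * c) ≡ a * c * (b * c)
    interchange = solve-∀
    rearrange : ∀ a b c → a * b * (c * a) ≡ a * a * b * c
    rearrange = solve-∀

  open SemiDirect N H θ
  open DSRG _≟G_ elemsG (cayleyArc (inN1xH N₁))

  out-degree : ∀ x → ListAction.sum (map (A x) elemsG) ≡ m * |N₁|
  out-degree (a , h) = begin
    ListAction.sum (map (A (a , h)) elemsG)   ≡⟨ sum-allFin×allFin (A (a , h)) ⟩
    ∑[ b < n ] ∑[ h′ < m ] 𝟙 (N₁ (b ∙ θ h′ α)) ≡⟨ ∑-comm (λ b h′ → 𝟙 (N₁ (b ∙ θ h′ α))) ⟩
    ∑[ h′ < m ] ∑[ b < n ] 𝟙 (N₁ (b ∙ θ h′ α))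
      ≡⟨ sum-cong-≗ (λ h′ → ∑-permute (𝟙 ∘ N₁) (translateʳ (θ h′ α))) ⟨
    ∑[ h′ < m ] |N₁|                          ≡⟨ ∑-const m |N₁| ⟩
    m * |N₁|                                  ∎
    where α = θ (h ℍ.⁻¹) (a ⁻¹)

  in-degree : ∀ y → ListAction.sum (map (λ x → A x y) elemsG) ≡ m * |N₁|
  in-degree (b , h′) = begin
    ListAction.sum (map (λ x → A x (b , h′)) elemsG) ≡⟨ sum-allFin×allFin (λ x → A x (b , h′)) ⟩
    ∑[ a < n ] ∑[ h < m ] 𝟙 (N₁ (arrival h a))       ≡⟨ ∑-comm (λ a h → 𝟙 (N₁ (arrival h a))) ⟩
    ∑[ h < m ] ∑[ a < n ] 𝟙 (N₁ (arrival h a))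
      ≡⟨ sum-cong-≗ (λ h → ∑-permute (𝟙 ∘ N₁)
           (inversion ∘ₚ θ-permutation (h ℍ.⁻¹) ∘ₚ θ-permutation h′ ∘ₚ translateˡ b)) ⟨
    ∑[ h < m ] |N₁|                                  ≡⟨ ∑-const m |N₁| ⟩
    m * |N₁|                                         ∎
    where
    arrival : Fin m → Fin n → Fin n
    arrival h a = b ∙ θ h′ (θ (h ℍ.⁻¹) (a ⁻¹))

  -- Paths x → (c , k) → y are counted by first substituting c ↦ θ k c, which makes the
  -- second arc independent of k; summing over k then produces hits.
  two-step : ∀ x y → ListAction.sum (map (λ z → A x z * A z y) elemsG) + K * A x y ≡ K * |N₁|
  two-step (a , h) (b , h′) = begin
    ListAction.sum (map (λ z → A (a , h) z * A z (b , h′)) elemsG) + K * A (a , h) (b , h′)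
      ≡⟨ cong₂ (λ s t → s + K * t) (sum-allFin×allFin (λ z → A (a , h) z * A z (b , h′)))
                                   (cong (𝟙 ∘ N₁ ∘ (b ∙_) ∘ θ h′) (sym (⁻¹-involutive α))) ⟩
    ∑[ c < n ] ∑[ k < m ] path c k + K * g (α ⁻¹)
      ≡⟨ cong (_+ K * g (α ⁻¹)) paths ⟩
    ∑[ c < n ] (hits (c ∙ α) * g c) + K * g (α ⁻¹)
      ≡⟨ ∑-punctured (α ⁻¹) K (λ c → hits (c ∙ α)) g hits+δ-translated ⟩
    K * ∑[ c < n ] g c
      ≡⟨ cong (K *_) (∑-permute (𝟙 ∘ N₁) (inversion ∘ₚ θ-permutation h′ ∘ₚ translateˡ b)) ⟨
    K * |N₁| ∎
    where
    α : Fin n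
    α = θ (h ℍ.⁻¹) (a ⁻¹)

    g : Fin n → ℕ
    g c = 𝟙 (N₁ (b ∙ θ h′ (c ⁻¹)))

    path : Fin n → Fin m → ℕ
    path c k = 𝟙 (N₁ (c ∙ θ k α)) * 𝟙 (N₁ (b ∙ θ h′ (θ (k ℍ.⁻¹) (c ⁻¹))))

    path-θ : ∀ k c → path (θ k c) k ≡ 𝟙 (N₁ (θ k (c ∙ α))) * g c
    path-θ k c = cong₂ (λ u v → 𝟙 (N₁ u) * 𝟙 (N₁ (b ∙ θ h′ v)))
      (sym (θ-hom-N k c α))
      (trans (cong (θ (k ℍ.⁻¹)) (sym (θ-⁻¹ k c))) (θ-inverseˡ k (c ⁻¹)))

    paths : ∑[ c < n ] ∑[ k < m ] path c k ≡ ∑[ c < n ] (hits (c ∙ α) * g c)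
    paths = begin
      ∑[ c < n ] ∑[ k < m ] path c k              ≡⟨ ∑-comm path ⟩
      ∑[ k < m ] ∑[ c < n ] path c k
        ≡⟨ sum-cong-≗ (λ k → ∑-permute (λ c → path c k) (θ-permutation k)) ⟩
      ∑[ k < m ] ∑[ c < n ] path (θ k c) k
        ≡⟨ sum-cong-≗ (λ k → sum-cong-≗ (path-θ k)) ⟩
      ∑[ k < m ] ∑[ c < n ] (𝟙 (N₁ (θ k (c ∙ α))) * g c)
        ≡⟨ ∑-comm (λ k c → 𝟙 (N₁ (θ k (c ∙ α))) * g c) ⟩
      ∑[ c < n ] ∑[ k < m ] (𝟙 (N₁ (θ k (c ∙ α))) * g c)
        ≡⟨ sum-cong-≗ (λ c → *-distribʳ-sum (g c) (λ k → 𝟙 (N₁ (θ k (c ∙ α))))) ⟨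
      ∑[ c < n ] (hits (c ∙ α) * g c)              ∎

    hits+δ-translated : ∀ c → hits (c ∙ α) + δ (α ⁻¹) c * K ≡ K
    hits+δ-translated c = begin
      hits (c ∙ α) + δ (α ⁻¹) c * K
        ≡⟨ cong (λ t → hits (c ∙ α) + t * K)
                (δ-injective (λ {u} {v} → cancelʳ α u v) (α ⁻¹) c) ⟨
      hits (c ∙ α) + δ (α ⁻¹ ∙ α) (c ∙ α) * K
        ≡⟨ cong (λ e → hits (c ∙ α) + δ e (c ∙ α) * K) (inverseˡ α) ⟩
      hits (c ∙ α) + δ ε (c ∙ α) * K ≡⟨ hits+δ (c ∙ α) ⟩
      K ∎

  loopless : ∀ x → cayleyArc (inN1xH N₁) x x ≡ false
  loopless (a , h) = trans (cong (λ t → N₁ (a ∙ t)) (θ-inverseʳ h (a ⁻¹)))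
                           (trans (cong N₁ (inverseʳ a)) N₁-ε)

  arc-irreflexive : ∀ x y → does (x ≟G y) ≡ true → cayleyArc (inN1xH N₁) x y ≡ false
  arc-irreflexive x y x≡y with x ≟G y
  arc-irreflexive x .x _ | yes refl = loopless x
  arc-irreflexive x y () | no _

  isDSRG : IsDSRG (n * m) ((r * m * (n ∸ 1)) ÷ d₂)
             ((r * r * m * (n ∸ 1)) ÷ (d₂ * d₂))
             (((r * r * m * (n ∸ 1)) ÷ (d₂ * d₂)) ∸ K)
             ((r * r * m * (n ∸ 1)) ÷ (d₂ * d₂))
  isDSRG = record
    { order = trans (length-cartesianProduct (allFin n) (allFin m))
                    (cong₂ _*_ (List.length-tabulate {n = n} id) (List.length-tabulate {n = m} id))
    ; JA = λ y → trans (in-degree y) (sym degree-value)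
    ; AJ = λ x → trans (out-degree x) (sym degree-value)
    ; A² = λ x y → dsrg-entry {c = K} (does (x ≟G y)) (cayleyArc (inN1xH N₁) x y) (arc-irreflexive x y)
                              (trans (two-step x y) (sym μ-value))
    }

mainTheorem8 : {n m : ℕ} (N : FinGroup n) (H : FinGroup m)
    (θ : Fin m → Fin n → Fin n) → IsAutAction N H θ →
    (d₂ : ℕ) (x₂ : Fin n) → x₂ ≢ FinGroup.ε N → orbitSize θ x₂ ≡ d₂ → 1 < d₂ →
    (∀ x → x ≢ FinGroup.ε N → d₂ ∣ orbitSize θ x) →
    (r : ℕ) → 1 ≤ r → r < d₂ →
    (N₁ : Fin n → Bool) → N₁ (FinGroup.ε N) ≡ false →
    (∀ x → x ≢ FinGroup.ε N → orbitPartSize θ N₁ x ≡ (r * orbitSize θ x) ÷ d₂) →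
    let open SemiDirect N H θ in
    DSRG.IsDSRG _≟G_ elemsG (cayleyArc (inN1xH N₁))
    (n * m)
    ((r * m * (n ∸ 1)) ÷ d₂)
    ((r * r * m * (n ∸ 1)) ÷ (d₂ * d₂))
    (((r * r * m * (n ∸ 1)) ÷ (d₂ * d₂)) ∸ ((r * m) ÷ d₂))
    ((r * r * m * (n ∸ 1)) ÷ (d₂ * d₂))
mainTheorem8 N H θ act (suc d) x₂ x₂≢ε _ (s≤s _) d₂∣orbit r _ _ N₁ N₁-ε N₁-orbit =
  CayleyDigraph.isDSRG act d x₂ x₂≢ε r N₁ N₁-ε d₂∣orbit N₁-orbit
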